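{- For every $c\geq 2$ let $L_c=(1,2,c)$. Then $$\lim_{c\to\infty}\rho_{2,L_c}=\frac{1}{6}.$$
   Context: Let $X$ be an alphabet with $n$ letters and $X^*$ the set of words over $X$. A code over $X$ is a finite sequence $C=(v_1,\ldots,v_m)$ of words over $X$ such that every $w\in X^*$ has at most one factorization into code-words: if $w=v_{i_1}\cdots v_{i_l}=v_{j_1}\cdots v_{j_{l'}}$ with $l,l'\geq 1$, then $l=l'$ and $i_t=j_t$ for all $t$. A code $(v_1,\ldots,v_m)$ is a prefix code if for all $i,j$, $v_i$ is a prefix of $v_j$ iff $i=j$. For a finite sequence $L=(a_1,\ldots,a_m)$ of natural numbers, $UD_n(L)$ is the set of codes $(v_1,\ldots,v_m)$ over $X$ with $|v_i|=a_i$ for all $i$, $PR_n(L)\subseteq UD_n(L)$ is the subset of prefix codes, and $\rho_{n,L}=|PR_n(L)|/|UD_n(L)|$. Here $n=2$. -}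

module Defs where

open import Data.Nat using (ℕ; zero; suc)
open import Data.Fin using (Fin)
open import Data.List using (List; []; _∷_; concat; map; length; _++_)
open import Data.List.Relation.Unary.All using (All)
open import Data.List.Relation.Unary.Unique.Propositional using (Unique)
open import Data.List.Membership.Propositional using (_∈_)
open import Data.Vec using (Vec; lookup; []; _∷_)
open import Data.Product using (Σ; _×_; ∃)
open import Relation.Binary.PropositionalEquality using (_≡_; _≢_)
open import Function.Bundles using (_⇔_)
open import Data.Integer using (+_)
open import Data.Rational using (ℚ; 0ℚ; _/_)

Word : ℕ → Set
Word n = List (Fin n)

WordSeq : ℕ → ℕ → Set
WordSeq n m = Vec (Word n) m

flatten : ∀ {n m} → WordSeq n m → List (Fin m) → Word n
flatten C is = concat (map (lookup C) is)

IsCode : ∀ {n m} → WordSeq n m → Set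
IsCode {n} {m} C = (is js : List (Fin m)) → is ≢ [] → js ≢ [] →
  flatten C is ≡ flatten C js → is ≡ js

IsPrefix : ∀ {n} → Word n → Word n → Set
IsPrefix {n} u v = ∃ λ (s : Word n) → u ++ s ≡ v

IsPrefixCode : ∀ {n m} → WordSeq n m → Set
IsPrefixCode {n} {m} C =
  IsCode C × ((i j : Fin m) → IsPrefix (lookup C i) (lookup C j) ⇔ (i ≡ j))

HasLengths : ∀ {n m} → Vec ℕ m → WordSeq n m → Set
HasLengths {n} {m} L C = (i : Fin m) → length (lookup C i) ≡ lookup L i

InUD : ∀ n {m} → Vec ℕ m → WordSeq n m → Set
InUD n L C = HasLengths L C × IsCode C

InPR : ∀ n {m} → Vec ℕ m → WordSeq n m → Set
InPR n L C = HasLengths L C × IsPrefixCode C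

HasCard : {A : Set} → (A → Set) → ℕ → Set
HasCard {A} P k = Σ (List A) λ xs →
  (length xs ≡ k) × Unique xs × All P xs × ((x : A) → P x → x ∈ xs)

-- the rational p / u (with the convention p / 0 = 0, never used since UD is nonempty)
ratio : ℕ → ℕ → ℚ
ratio p zero = 0ℚ
ratio p (suc u) = (+ p) / suc u

Lc : ℕ → Vec ℕ 3
Lc c = 1 ∷ 2 ∷ c ∷ []

module Submission where

open import Defs
open import Data.Nat using (ℕ; zero; suc; _+_; _*_; _^_; _∸_; _≤_; _≥_; z≤n; s≤s; NonZero)
import Data.Nat as ℕ
open import Data.Nat.Properties
  using (≤-refl; ≤-trans; ≤-reflexive; ≤-pred; suc-injective; 1+n≰n; n≤0⇒n≡0; m<n⇒n≢0; m≤n⇒m≤1+n;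
         m≤m+n; m≤n+m; m<m+n; +-identityʳ; +-suc; +-assoc; +-comm; +-mono-≤; +-monoˡ-≤; +-monoʳ-≤;
         *-comm; *-assoc; *-distribʳ-+; *-distribʳ-∸; *-monoˡ-≤; *-monoʳ-≤; *-monoˡ-<; *-monoʳ-<; *-cancelˡ-<;
         m^n≢0; ^-distribˡ-+-*; ^-*-assoc; m∸n+n≡m; m+n∸n≡m; m+[n∸m]≡n; m≤n+o⇒m∸n≤o; m+n≤o⇒m≤o∸n;
         module ≤-Reasoning)
open import Data.Nat.ListAction using (sum)
open import Data.Nat.ListAction.Properties using (sum-++)
open import Data.Nat.Coprimality using (Coprime)
open import Data.Nat.Tactic.RingSolver using (solve-∀)
open import Data.Integer as ℤ using (+_; +[1+_]; -[1+_]; +<+)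
import Data.Integer.Properties as ℤₚ
open import Data.Rational using (ℚ; mkℚ; 0ℚ; _<_; _-_; ∣_∣; _/_; *<*; toℚᵘ; fromℚᵘ)
import Data.Rational as ℚ
import Data.Rational.Properties as ℚₚ
import Data.Rational.Unnormalised as ℚᵘ
import Data.Rational.Unnormalised.Properties as ℚᵘₚ
open import Data.Fin using (Fin; zero; suc)
open import Data.Fin.Properties using (_≟_; any?; all?)
open import Data.List using (List; []; _∷_; map; length; _++_; reverse; filter; cartesianProduct; concatMap; allFin)
open import Data.List.Properties
  using (≡-dec; ++-assoc; ++-identityʳ; ∷-injective; ∷-injectiveˡ; ∷-injectiveʳ; ++-cancelˡ; ++-conicalˡ;
         length-++; length-map; length-filter; filter-++; filter-all; filter-none; map-++; map-∘; map-cong-local;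
         reverse-++; reverse-injective; unfold-reverse; reverse-involutive)
open import Data.List.Relation.Unary.Any using (Any; here; there)
import Data.List.Relation.Unary.Any as Any
open import Data.List.Relation.Unary.All using (All; []; _∷_)
import Data.List.Relation.Unary.All as All
open import Data.List.Relation.Unary.All.Properties using (all-filter)
open import Data.List.Relation.Unary.AllPairs using ([]; _∷_)
open import Data.List.Relation.Unary.Unique.Propositional using (Unique)
open import Data.List.Relation.Unary.Unique.Propositional.Properties using (map⁺; ++⁺; cartesianProduct⁺; filter⁺)
open import Data.List.Membership.Propositional using (_∈_; find; lose)
open import Data.List.Membership.Propositional.Properties
  using (∈-map⁺; ∈-map⁻; ∈-++⁺ˡ; ∈-++⁺ʳ; ∈-++⁻; ∈-filter⁺; ∈-cartesianProduct⁺; ∈-cartesianProduct⁻;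
         ∈-concatMap⁺; ∈-allFin)
open import Data.Vec using (Vec; lookup)
import Data.Vec as Vec
import Data.Vec.Properties as Vecₚ
open import Data.Product using (Σ; ∃; ∃₂; _×_; _,_; proj₁)
open import Data.Sum using (_⊎_; inj₁; inj₂; [_,_]′)
open import Data.Empty using (⊥; ⊥-elim)
open import Function using (_∘′_; case_of_)
open import Function.Bundles using (_⇔_; mk⇔; Equivalence)
open import Relation.Nullary using (¬_; Dec; yes; no)
open import Relation.Nullary.Decidable using (¬?; _×-dec_; _⊎-dec_; _→-dec_; map′; decidable-stable)
open import Relation.Nullary.Negation using (¬∃⟶∀¬)
open import Relation.Unary using (Decidable)
open import Relation.Binary.Definitions using (DecidableEquality)
open import Relation.Binary.PropositionalEquality
  using (_≡_; _≢_; refl; sym; trans; cong; cong₂; subst; subst₂; module ≡-Reasoning)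

-- Write a code with lengths (1, 2, c) over {x, y} as (a, b, w) and count the words w for each of
-- the eight pairs (a, b). The triple is a prefix code exactly when b starts with the letter other
-- than a and w starts with the first letter of b followed by the letter other than b's second one,
-- which gives 2^c prefix codes. The pairs (x, xx) never give codes. Each of the other six pairs gives
-- a code for every w containing a fixed factor q of length at most 3 (xyx for (x, yy), and yy for
-- (x, xy) and (x, yx)): the Sardinas–Patterson dangling suffixes stay proper suffixes of w outside
-- the submonoid generated by a and b, which avoids q, the key case being w = d ++ s with d a proper
-- suffix of w, which makes w a factor of a power of s. At most 7^k 2^r words of length 3k + r avoid
-- q, so the number u of codes satisfies 6·2^c - 6·7^k 2^r ≤ u ≤ 6·2^c, and 2^c / u → 1/6.

private variable
  A B : Set

count : {P : A → Set} → Decidable P → List A → ℕ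
count P? xs = length (filter P? xs)

count-≤-length : {P : A → Set} (P? : Decidable P) (xs : List A) → count P? xs ≤ length xs
count-≤-length P? = length-filter P?

count-all : {P : A → Set} (P? : Decidable P) (xs : List A) → (∀ {x} → x ∈ xs → P x) → count P? xs ≡ length xs
count-all P? xs all = cong length (filter-all P? (All.tabulate all))

count-none : {P : A → Set} (P? : Decidable P) (xs : List A) → (∀ {x} → x ∈ xs → ¬ P x) → count P? xs ≡ 0
count-none P? xs none = cong length (filter-none P? (All.tabulate none))

count-mono : {P Q : A → Set} (P? : Decidable P) (Q? : Decidable Q) (xs : List A) →
             (∀ {x} → x ∈ xs → P x → Q x) → count P? xs ≤ count Q? xs
count-mono P? Q? []       P⇒Q = z≤n
count-mono P? Q? (x ∷ xs) P⇒Q with P? x | Q? x | count-mono P? Q? xs (P⇒Q ∘′ there)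
... | yes _  | yes _  | ih = s≤s ih
... | yes px | no ¬qx | _  = ⊥-elim (¬qx (P⇒Q (here refl) px))
... | no _   | yes _  | ih = m≤n⇒m≤1+n ih
... | no _   | no _   | ih = ih

count-mono-< : {P Q : A → Set} (P? : Decidable P) (Q? : Decidable Q) (xs : List A) →
               (∀ {x} → x ∈ xs → P x → Q x) → ∀ {a} → a ∈ xs → Q a → ¬ P a →
               count P? xs ℕ.< count Q? xs
count-mono-< P? Q? (x ∷ xs) P⇒Q (here refl) qa ¬pa with P? x | Q? x
... | yes pa | _      = ⊥-elim (¬pa pa)
... | no _   | yes _  = s≤s (count-mono P? Q? xs (P⇒Q ∘′ there))
... | no _   | no ¬qa = ⊥-elim (¬qa qa)
count-mono-< P? Q? (x ∷ xs) P⇒Q (there a∈xs) qa ¬pa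
  with P? x | Q? x | count-mono-< P? Q? xs (P⇒Q ∘′ there) a∈xs qa ¬pa
... | yes _  | yes _  | ih = s≤s ih
... | yes px | no ¬qx | _  = ⊥-elim (¬qx (P⇒Q (here refl) px))
... | no _   | yes _  | ih = m≤n⇒m≤1+n ih
... | no _   | no _   | ih = ih

count-++ : {P : A → Set} (P? : Decidable P) (xs ys : List A) →
           count P? (xs ++ ys) ≡ count P? xs + count P? ys
count-++ P? xs ys = trans (cong length (filter-++ P? xs ys)) (length-++ (filter P? xs))

count-map : {P : B → Set} (P? : Decidable P) (f : A → B) (xs : List A) →
            count P? (map f xs) ≡ count (λ x → P? (f x)) xs
count-map P? f []       = refl
count-map P? f (x ∷ xs) with P? (f x)
... | yes _ = cong suc (count-map P? f xs)
... | no _  = count-map P? f xs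

count-complement : {P : A → Set} (P? : Decidable P) (xs : List A) →
                   count P? xs + count (λ x → ¬? (P? x)) xs ≡ length xs
count-complement P? []       = refl
count-complement P? (x ∷ xs) with P? x
... | yes _ = cong suc (count-complement P? xs)
... | no _  = trans (+-suc _ _) (cong suc (count-complement P? xs))

count-cartesianProduct : {P : A × B → Set} (P? : Decidable P) (xs : List A) (ys : List B) →
  count P? (cartesianProduct xs ys) ≡ sum (map (λ x → count (λ y → P? (x , y)) ys) xs)
count-cartesianProduct P? []       ys = refl
count-cartesianProduct P? (x ∷ xs) ys =
  trans (count-++ P? (map (x ,_) ys) _)
        (cong₂ _+_ (count-map P? (x ,_) ys) (count-cartesianProduct P? xs ys))

sum≤count* : {P : A → Set} (P? : Decidable P) (f : A → ℕ) (N : ℕ) (xs : List A) →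
               (∀ {x} → x ∈ xs → P x → f x ≤ N) → (∀ {x} → x ∈ xs → ¬ P x → f x ≡ 0) →
               sum (map f xs) ≤ count P? xs * N
sum≤count* P? f N []       _ _ = z≤n
sum≤count* P? f N (x ∷ xs) ≤N ≡0 with P? x | sum≤count* P? f N xs (≤N ∘′ there) (≡0 ∘′ there)
... | yes px | ih = +-mono-≤ (≤N (here refl) px) ih
... | no ¬px | ih = subst (λ t → t + sum (map f xs) ≤ count P? xs * N) (sym (≡0 (here refl) ¬px)) ih

sum≡count* : {P : A → Set} (P? : Decidable P) (f : A → ℕ) (N : ℕ) (xs : List A) →
               (∀ {x} → x ∈ xs → P x → f x ≡ N) → (∀ {x} → x ∈ xs → ¬ P x → f x ≡ 0) →
               sum (map f xs) ≡ count P? xs * N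
sum≡count* P? f N []       _ _ = refl
sum≡count* P? f N (x ∷ xs) ≡N ≡0 with P? x | sum≡count* P? f N xs (≡N ∘′ there) (≡0 ∘′ there)
... | yes px | ih = cong₂ _+_ (≡N (here refl) px) ih
... | no ¬px | ih = cong₂ _+_ (≡0 (here refl) ¬px) ih

count*≤sum+count* : {P : A → Set} (P? : Decidable P) (f : A → ℕ) (N b : ℕ) (xs : List A) →
  (∀ {x} → x ∈ xs → P x → N ≤ f x + b) → count P? xs * N ≤ sum (map f xs) + count P? xs * b
count*≤sum+count* P? f N b []       _ = z≤n
count*≤sum+count* P? f N b (x ∷ xs) ≤f+b
  with P? x | count*≤sum+count* P? f N b xs (≤f+b ∘′ there)
... | yes px | ih = ≤-trans (+-mono-≤ (≤f+b (here refl) px) ih) (≤-reflexive (lemma (f x) b _ _))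
  where
    lemma : ∀ a b c d → (a + b) + (c + d) ≡ (a + c) + (b + d)
    lemma = solve-∀
... | no _   | ih = ≤-trans ih (+-monoˡ-≤ _ (m≤n+m _ (f x)))

sum+b≤length*b : (f : A → ℕ) (b : ℕ) (xs : List A) → (∀ {x} → x ∈ xs → f x ≤ b) →
                         ∀ {a} → a ∈ xs → f a ≡ 0 → sum (map f xs) + b ≤ length xs * b
sum+b≤length*b f b (x ∷ xs) ≤b (here refl) fx≡0 = begin
  (f x + sum (map f xs)) + b ≡⟨ cong (λ t → (t + sum (map f xs)) + b) fx≡0 ⟩
  sum (map f xs) + b        ≡⟨ +-comm _ b ⟩
  b + sum (map f xs)        ≤⟨ +-monoʳ-≤ b (sum-≤ xs (≤b ∘′ there)) ⟩
  b + length xs * b         ∎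
  where
    open ≤-Reasoning
    sum-≤ : ∀ ys → (∀ {y} → y ∈ ys → f y ≤ b) → sum (map f ys) ≤ length ys * b
    sum-≤ []       _   = z≤n
    sum-≤ (y ∷ ys) ≤b′ = +-mono-≤ (≤b′ (here refl)) (sum-≤ ys (≤b′ ∘′ there))
sum+b≤length*b f b (x ∷ xs) ≤b (there a∈xs) fa≡0 = begin
  (f x + sum (map f xs)) + b ≡⟨ +-assoc (f x) _ b ⟩
  f x + (sum (map f xs) + b) ≤⟨ +-mono-≤ (≤b (here refl)) (sum+b≤length*b f b xs (≤b ∘′ there) a∈xs fa≡0) ⟩
  b + length xs * b         ∎
  where open ≤-Reasoning

sum-map-*ʳ : (f : A → ℕ) (N : ℕ) (xs : List A) → sum (map (λ x → f x * N) xs) ≡ sum (map f xs) * N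
sum-map-*ʳ f N []       = refl
sum-map-*ʳ f N (x ∷ xs) = trans (cong (_+_ (f x * N)) (sum-map-*ʳ f N xs)) (sym (*-distribʳ-+ N (f x) _))

data Levi {A : Set} (a b c d : List A) : Set where
  c⊑a : (m : List A) → a ≡ c ++ m → d ≡ m ++ b → Levi a b c d
  a⊑c : (m : List A) → c ≡ a ++ m → b ≡ m ++ d → Levi a b c d

levi : {A : Set} (a b c d : List A) → a ++ b ≡ c ++ d → Levi a b c d
levi []      b c       d eq = a⊑c c refl eq
levi (x ∷ a) b []      d eq = c⊑a (x ∷ a) refl (sym eq)
levi (x ∷ a) b (y ∷ c) d eq with ∷-injective eq
... | refl , eq′ with levi a b c d eq′
...   | c⊑a m p q = c⊑a m (cong (x ∷_) p) q
...   | a⊑c m p q = a⊑c m (cong (x ∷_) p) q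

isPrefix? : DecidableEquality A → (u v : List A) → Dec (∃ λ s → u ++ s ≡ v)
isPrefix? _≟_ []      v       = yes (v , refl)
isPrefix? _≟_ (a ∷ u) []      = no λ ()
isPrefix? _≟_ (a ∷ u) (b ∷ v) with a ≟ b | isPrefix? _≟_ u v
... | yes refl | yes (s , e) = yes (s , cong (a ∷_) e)
... | yes refl | no ¬pre     = no λ (s , e) → ¬pre (s , ∷-injectiveʳ e)
... | no a≢b   | _           = no λ (s , e) → a≢b (∷-injectiveˡ e)

data Factor {A : Set} (p : List A) : List A → Set where
  here  : ∀ r → Factor p (p ++ r)
  there : ∀ {t} a → Factor p t → Factor p (a ∷ t)

factor-inv : {p t : List A} → Factor p t →
             (∃ λ r → p ++ r ≡ t) ⊎ (∃₂ λ a t′ → a ∷ t′ ≡ t × Factor p t′)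
factor-inv (here r)    = inj₁ (r , refl)
factor-inv (there a f) = inj₂ (a , _ , refl , f)

factor? : DecidableEquality A → (p t : List A) → Dec (Factor p t)
factor? _≟_ p [] with isPrefix? _≟_ p []
... | yes (r , e) = yes (subst (Factor p) e (here r))
... | no ¬pre     = no λ f → [ ¬pre , (λ { (_ , _ , () , _) }) ]′ (factor-inv f)
factor? _≟_ p (a ∷ t) with isPrefix? _≟_ p (a ∷ t) | factor? _≟_ p t
... | yes (r , e) | _     = yes (subst (Factor p) e (here r))
... | no _        | yes f = yes (there a f)
... | no ¬pre     | no ¬f =
  no λ f → [ ¬pre , (λ (_ , _ , e , f′) → ¬f (subst (Factor p) (∷-injectiveʳ e) f′)) ]′ (factor-inv f)

¬Factor-[] : {b : A} {p : List A} → ¬ Factor (b ∷ p) []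
¬Factor-[] f with factor-inv f
... | inj₁ (_ , ())
... | inj₂ (_ , _ , () , _)

Factor-∷⁻ : {a b : A} {p t : List A} → a ≢ b → Factor (b ∷ p) (a ∷ t) → Factor (b ∷ p) t
Factor-∷⁻ a≢b f with factor-inv f
... | inj₁ (_ , e)          = ⊥-elim (a≢b (sym (∷-injectiveˡ e)))
... | inj₂ (_ , _ , e , f′) = subst (Factor _) (∷-injectiveʳ e) f′

factor-refl : (p : List A) → Factor p p
factor-refl p = subst (Factor p) (++-identityʳ p) (here [])

factor-++ˡ : {p : List A} (u : List A) {v : List A} → Factor p v → Factor p (u ++ v)
factor-++ˡ []      f = f
factor-++ˡ (a ∷ u) f = there a (factor-++ˡ u f)

factor-++ʳ : {p u : List A} (v : List A) → Factor p u → Factor p (u ++ v)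
factor-++ʳ {p = p} v (here r)    = subst (Factor p) (sym (++-assoc p r v)) (here (r ++ v))
factor-++ʳ         v (there a f) = there a (factor-++ʳ v f)

factor-trans : {p u t : List A} → Factor p u → Factor u t → Factor p t
factor-trans {u = u} f (here r)     = factor-++ʳ r f
factor-trans         f (there a f′) = there a (factor-trans f f′)

factor-split : {p t : List A} → Factor p t → ∃₂ λ a b → a ++ p ++ b ≡ t
factor-split (here r)    = [] , r , refl
factor-split (there a f) with factor-split f
... | a′ , b , e = a ∷ a′ , b , cong (a ∷_) e

factor-reverse : {p t : List A} → Factor p t → Factor (reverse p) (reverse t)
factor-reverse {p = p} f with factor-split f
... | a , b , refl = subst (Factor (reverse p)) (sym (reverse-a++p++b))
                       (factor-++ˡ (reverse b) (factor-++ʳ (reverse a) (factor-refl (reverse p))))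
  where
    reverse-a++p++b : reverse (a ++ p ++ b) ≡ reverse b ++ reverse p ++ reverse a
    reverse-a++p++b = begin
      reverse (a ++ p ++ b)               ≡⟨ reverse-++ a (p ++ b) ⟩
      reverse (p ++ b) ++ reverse a       ≡⟨ cong (_++ reverse a) (reverse-++ p b) ⟩
      (reverse b ++ reverse p) ++ reverse a ≡⟨ ++-assoc (reverse b) _ _ ⟩
      reverse b ++ reverse p ++ reverse a ∎
      where open ≡-Reasoning

data Star {A : Set} (X : List A → Set) : List A → Set where
  []  : Star X []
  _∷_ : ∀ {u r} → X u → Star X r → Star X (u ++ r)

Star-++ : {X : List A → Set} {u v : List A} → Star X u → Star X v → Star X (u ++ v)
Star-++         []                      sv = sv
Star-++ {X = X} {v = v} (_∷_ {u} {r} xu su) sv = subst (Star X) (sym (++-assoc u r v)) (xu ∷ Star-++ su sv)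

power : ℕ → List A → List A
power zero    s = []
power (suc k) s = power k s ++ s

Star-power : {X : List A → Set} {s : List A} (k : ℕ) → Star X s → Star X (power k s)
Star-power zero    _  = []
Star-power (suc k) ss = Star-++ (Star-power k ss) ss

-- d is a border of e ++ d ≡ d ++ s, so it has period |s| and ends a power of s.
border-power : (fuel : ℕ) {e d s : List A} → length d ≤ fuel → s ≢ [] → e ++ d ≡ d ++ s →
               ∃₂ λ k pre → pre ++ d ≡ power k s
border-power fuel {[]} {d} _ s≢[] eq = ⊥-elim (s≢[] (sym (++-cancelˡ d [] _ (trans (++-identityʳ d) eq))))
border-power fuel {x ∷ e} {d} {s} bound s≢[] eq with levi (x ∷ e) d d s eq
... | c⊑a m _ s≡m++d = 1 , m , sym s≡m++d
border-power zero    {x ∷ e} {[]}    _ _ _ | a⊑c m () _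
border-power (suc fuel) {x ∷ e} {d} {s} bound s≢[] eq | a⊑c m d≡xe++m d≡m++s
  with border-power fuel shorter s≢[] (trans (sym d≡xe++m) d≡m++s)
  where
    shorter : length m ≤ fuel
    shorter = ≤-pred (≤-trans (s≤s (subst (length m ≤_) (sym (length-++ e)) (m≤n+m _ (length e))))
                               (subst (_≤ suc fuel) (cong length d≡xe++m) bound))
... | k , pre , pre++m≡sᵏ = suc k , pre , (begin
  pre ++ d        ≡⟨ cong (pre ++_) d≡m++s ⟩
  pre ++ m ++ s   ≡⟨ sym (++-assoc pre m s) ⟩
  (pre ++ m) ++ s ≡⟨ cong (_++ s) pre++m≡sᵏ ⟩
  power k s ++ s  ∎)
  where open ≡-Reasoning

factor-of-power : {e d s w : List A} → s ≢ [] → e ++ d ≡ w → w ≡ d ++ s → ∃ λ k → Factor w (power k s)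
factor-of-power {e = e} {d} {s} {w} s≢[] e++d≡w w≡d++s
  with border-power (length d) {e} ≤-refl s≢[] (trans e++d≡w w≡d++s)
... | k , pre , pre++d≡sᵏ = suc k , subst (Factor w) eq (factor-++ˡ pre (factor-refl w))
  where
    open ≡-Reasoning
    eq : pre ++ w ≡ power k s ++ s
    eq = begin
      pre ++ w        ≡⟨ cong (pre ++_) w≡d++s ⟩
      pre ++ d ++ s   ≡⟨ sym (++-assoc pre d s) ⟩
      (pre ++ d) ++ s ≡⟨ cong (_++ s) pre++d≡sᵏ ⟩
      power k s ++ s  ∎

ProperSuffix : List A → List A → Set
ProperSuffix {A} d w = ∃ λ (e : List A) → e ≢ [] × e ++ d ≡ w

ProperSuffix-≢++ : {d w s : List A} → ProperSuffix d w → d ≢ w ++ s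
ProperSuffix-≢++ {d = d} {w} {s} ([] , e≢[] , _) _ = e≢[] refl
ProperSuffix-≢++ {d = d} {w} {s} (a ∷ e , _ , a∷e++d≡w) d≡w++s = 1+n≰n (begin
  suc (length d)           ≤⟨ s≤s (m≤n+m (length d) (length e)) ⟩
  suc (length e + length d) ≡⟨ cong suc (sym (length-++ e)) ⟩
  length (a ∷ e ++ d)      ≡⟨ cong length a∷e++d≡w ⟩
  length w                 ≤⟨ m≤m+n (length w) (length s) ⟩
  length w + length s      ≡⟨ sym (length-++ w) ⟩
  length (w ++ s)          ≡⟨ cong length (sym d≡w++s) ⟩
  length d                 ∎)
  where open ≤-Reasoning

ProperSuffix-drop : {d w : List A} (u : List A) {s : List A} → ProperSuffix d w → d ≡ u ++ s → ProperSuffix s w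
ProperSuffix-drop u {s} ([] , e≢[] , _) _ = ⊥-elim (e≢[] refl)
ProperSuffix-drop u {s} (a ∷ e , _ , a∷e++d≡w) d≡u++s =
  a ∷ e ++ u , (λ ()) , trans (++-assoc (a ∷ e) u s) (trans (cong ((a ∷ e) ++_) (sym d≡u++s)) a∷e++d≡w)

ProperSuffix-split : {d w s : List A} → ProperSuffix d w → d ≢ [] → w ≡ d ++ s →
                     ProperSuffix s w × s ≢ []
ProperSuffix-split {d = d} {w} {s} d⊏w d≢[] w≡d++s = (d , d≢[] , sym w≡d++s) , s≢[]
  where
    s≢[] : s ≢ []
    s≢[] refl = ProperSuffix-≢++ d⊏w (trans (sym (trans w≡d++s (++-identityʳ d))) (sym (++-identityʳ w)))

module _ {n : ℕ} where

  IsPrefix-refl : (u : Word n) → IsPrefix u u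
  IsPrefix-refl u = [] , ++-identityʳ u

  IsPrefix-++ : {u v : Word n} (t : Word n) → IsPrefix u v → IsPrefix u (v ++ t)
  IsPrefix-++ {u} t (s , refl) = s ++ t , sym (++-assoc u s t)

  IsPrefix-++⁻ˡ : {u t v : Word n} → IsPrefix (u ++ t) v → IsPrefix u v
  IsPrefix-++⁻ˡ {u} {t} (s , e) = t ++ s , trans (sym (++-assoc u t s)) e

  IsPrefix-length : {u v : Word n} → IsPrefix u v → length u ≤ length v
  IsPrefix-length {u} (s , refl) = subst (length u ≤_) (sym (length-++ u)) (m≤m+n (length u) (length s))

  IsPrefix-≡ : {u v : Word n} → IsPrefix u v → length v ≤ length u → u ≡ v
  IsPrefix-≡ {u} ([]    , refl) _ = sym (++-identityʳ u)
  IsPrefix-≡ {u} (x ∷ s , refl) |v|≤|u| = ⊥-elim (1+n≰n (begin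
    suc (length u)           ≤⟨ m<m+n (length u) (s≤s z≤n) ⟩
    length u + length (x ∷ s) ≡⟨ sym (length-++ u) ⟩
    length (u ++ x ∷ s)      ≤⟨ |v|≤|u| ⟩
    length u                 ∎))
    where open ≤-Reasoning

  IsPrefix-++⁻ : {u v t : Word n} → IsPrefix u (v ++ t) → length u ≤ length v → IsPrefix u v
  IsPrefix-++⁻ {u} {v} {t} (s , e) |u|≤|v| with levi u s v t e
  ... | c⊑a m u≡v++m _ = subst (IsPrefix u) (sym (IsPrefix-≡ (m , sym u≡v++m) |u|≤|v|)) (IsPrefix-refl u)
  ... | a⊑c m v≡u++m _ = m , sym v≡u++m

flatten-++ : ∀ {n m} (C : WordSeq n m) (is js : List (Fin m)) →
             flatten C (is ++ js) ≡ flatten C is ++ flatten C js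
flatten-++ C []       js = refl
flatten-++ C (i ∷ is) js = trans (cong (lookup C i ++_) (flatten-++ C is js))
                                 (sym (++-assoc (lookup C i) _ _))

flatten-singleton : ∀ {n m} (C : WordSeq n m) (i : Fin m) → flatten C (i ∷ []) ≡ lookup C i
flatten-singleton C i = ++-identityʳ _

NonEmptyWords : ∀ {n m} → WordSeq n m → Set
NonEmptyWords C = ∀ k → lookup C k ≢ []

suffixes : {A : Set} → List A → List (List A)
suffixes []      = [] ∷ []
suffixes (x ∷ u) = (x ∷ u) ∷ suffixes u

∈-suffixes : {A : Set} (p : List A) {s t : List A} → p ++ s ≡ t → s ∈ suffixes t
∈-suffixes []      {[]}    refl = here refl
∈-suffixes []      {_ ∷ _} refl = here refl
∈-suffixes (x ∷ p) refl = there (∈-suffixes p refl)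

module Dangling {n m : ℕ} (C : WordSeq n m) where

  private
    cw : Fin m → Word n
    cw = lookup C

    F : List (Fin m) → Word n
    F = flatten C

    _≟W_ : DecidableEquality (Word n)
    _≟W_ = ≡-dec _≟_

    open import Data.List.Membership.DecPropositional _≟W_ using (_∈?_)

  -- The dangling suffixes of the Sardinas–Patterson test: with nonempty codewords,
  -- C is a code iff the empty word is not dangling.
  data Dangling : Word n → Set where
    start  : ∀ {i j s} → i ≢ j → cw i ≡ cw j ++ s → Dangling s
    strip  : ∀ {d k s} → Dangling d → d ≡ cw k ++ s → Dangling s
    absorb : ∀ {d k s} → Dangling d → cw k ≡ d ++ s → Dangling s

  -- Each step consumes one index of js, and the roles of is and js may swap.
  dangling-reaches-[] : ∀ {d} (fuel : ℕ) (is js : List (Fin m)) → length js + length is ≤ fuel →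
                        Dangling d → d ++ F is ≡ F js → Dangling []
  dangling-reaches-[] {d} _ is [] _ δ eq = subst Dangling (++-conicalˡ d (F is) eq) δ
  dangling-reaches-[] {d} (suc fuel) is (k ∷ js) (s≤s bound) δ eq with levi d (F is) (cw k) (F js) eq
  ... | c⊑a m p q = dangling-reaches-[] fuel is js bound (strip δ p) (sym q)
  ... | a⊑c m p q = dangling-reaches-[] fuel js is (subst (_≤ fuel) (+-comm (length js) _) bound)
                                        (absorb δ p) (sym q)

  isCode : NonEmptyWords C → ¬ Dangling [] → IsCode C
  isCode ne ¬δ []       _        is≢[] _ _  = ⊥-elim (is≢[] refl)
  isCode ne ¬δ (_ ∷ _)  []       _ js≢[] _  = ⊥-elim (js≢[] refl)
  isCode ne ¬δ (i ∷ is) (j ∷ js) _ _     eq with i ≟ j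
  ... | no i≢j with levi (cw i) (F is) (cw j) (F js) eq
  ...   | c⊑a m p q = ⊥-elim (¬δ (dangling-reaches-[] _ is js ≤-refl (start i≢j p) (sym q)))
  ...   | a⊑c m p q = ⊥-elim (¬δ (dangling-reaches-[] _ js is ≤-refl (start (i≢j ∘′ sym) p) (sym q)))

  isCode ne ¬δ (i ∷ is) (i ∷ js) _ _ eq | yes refl with is | js | ++-cancelˡ (cw i) (F is) (F js) eq
  ... | []     | []     | _ = refl
  ... | []     | k ∷ ks | e = ⊥-elim (ne k (++-conicalˡ (cw k) (F ks) (sym e)))
  ... | k ∷ ks | []     | e = ⊥-elim (ne k (++-conicalˡ (cw k) (F ks) e))
  ... | k ∷ ks | l ∷ ls | e = cong (i ∷_) (isCode ne ¬δ (k ∷ ks) (l ∷ ls) (λ ()) (λ ()) e)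

  record Ambiguity (s : Word n) : Set where
    constructor ambiguity
    field
      i j : Fin m
      is js : List (Fin m)
      i≢j : i ≢ j
      equation : F (i ∷ is) ++ s ≡ F (j ∷ js)

  ambiguity-of : ∀ {s} → Dangling s → Ambiguity s
  ambiguity-of (start {i} {j} {s} i≢j e) = ambiguity j i [] [] (λ e′ → i≢j (sym e′)) (begin
    F (j ∷ []) ++ s ≡⟨ cong (_++ s) (flatten-singleton C j) ⟩
    cw j ++ s       ≡⟨ sym e ⟩
    cw i            ≡⟨ sym (flatten-singleton C i) ⟩
    F (i ∷ [])      ∎)
    where open ≡-Reasoning
  ambiguity-of (strip {d} {k} {s} δ e) with ambiguity-of δ
  ... | ambiguity i j is js i≢j eq = ambiguity i j (is ++ k ∷ []) js i≢j (begin
    F (i ∷ is ++ k ∷ []) ++ s   ≡⟨ cong (_++ s) (flatten-++ C (i ∷ is) (k ∷ [])) ⟩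
    (F (i ∷ is) ++ F (k ∷ [])) ++ s ≡⟨ cong (λ t → (F (i ∷ is) ++ t) ++ s) (flatten-singleton C k) ⟩
    (F (i ∷ is) ++ cw k) ++ s   ≡⟨ ++-assoc (F (i ∷ is)) (cw k) s ⟩
    F (i ∷ is) ++ cw k ++ s     ≡⟨ cong (F (i ∷ is) ++_) (sym e) ⟩
    F (i ∷ is) ++ d             ≡⟨ eq ⟩
    F (j ∷ js)                  ∎)
    where open ≡-Reasoning
  ambiguity-of (absorb {d} {k} {s} δ e) with ambiguity-of δ
  ... | ambiguity i j is js i≢j eq = ambiguity j i js (is ++ k ∷ []) (λ e′ → i≢j (sym e′)) (begin
    F (j ∷ js) ++ s             ≡⟨ cong (_++ s) (sym eq) ⟩
    (F (i ∷ is) ++ d) ++ s      ≡⟨ ++-assoc (F (i ∷ is)) d s ⟩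
    F (i ∷ is) ++ d ++ s        ≡⟨ cong (F (i ∷ is) ++_) (sym e) ⟩
    F (i ∷ is) ++ cw k          ≡⟨ cong (F (i ∷ is) ++_) (sym (flatten-singleton C k)) ⟩
    F (i ∷ is) ++ F (k ∷ [])    ≡⟨ sym (flatten-++ C (i ∷ is) (k ∷ [])) ⟩
    F (i ∷ is ++ k ∷ [])        ∎)
    where open ≡-Reasoning

  ¬isCode : Dangling [] → ¬ IsCode C
  ¬isCode δ code with ambiguity-of δ
  ... | ambiguity i j is js i≢j eq =
    i≢j (proj₁ (∷-injective (code (i ∷ is) (j ∷ js) (λ ()) (λ ()) (trans (sym (++-identityʳ _)) eq))))


  record Invariant (D : Word n → Set) : Set where
    field
      ¬D[]    : ¬ D []
      start⇒  : ∀ {i j s} → i ≢ j → cw i ≡ cw j ++ s → D s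
      strip⇒  : ∀ {d k s} → D d → d ≡ cw k ++ s → D s
      absorb⇒ : ∀ {d k s} → D d → cw k ≡ d ++ s → D s

  isCode-by-invariant : NonEmptyWords C → ∀ {D} → Invariant D → IsCode C
  isCode-by-invariant ne {D} inv = isCode ne (¬D[] ∘′ dangling⇒D)
    where
      open Invariant inv
      dangling⇒D : ∀ {d} → Dangling d → D d
      dangling⇒D (start i≢j e)  = start⇒ i≢j e
      dangling⇒D (strip δ e)    = strip⇒ (dangling⇒D δ) e
      dangling⇒D (absorb δ e)   = absorb⇒ (dangling⇒D δ) e

  isCode-prefixFree : NonEmptyWords C → (∀ {i j} → i ≢ j → ¬ IsPrefix (cw j) (cw i)) → IsCode C
  isCode-prefixFree ne prefixFree = isCode-by-invariant ne {λ _ → ⊥} (record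
    { ¬D[] = λ () ; start⇒ = λ i≢j e → prefixFree i≢j (_ , sym e) ; strip⇒ = λ () ; absorb⇒ = λ () })

  candidates : List (Word n)
  candidates = concatMap (λ k → suffixes (cw k)) (allFin m)

  dangling-suffix : ∀ {d} → Dangling d → ∃₂ λ p k → p ++ d ≡ cw k
  dangling-suffix (start {i} {j} _ e)    = cw j , i , sym e
  dangling-suffix (strip {s = s} δ e) with dangling-suffix δ
  ... | p , k′ , e′ = p ++ cw _ , k′ , trans (++-assoc p _ s) (trans (cong (p ++_) (sym e)) e′)
  dangling-suffix (absorb {d} {k} δ e)  = d , k , sym e

  dangling∈candidates : ∀ {d} → Dangling d → d ∈ candidates
  dangling∈candidates δ with dangling-suffix δ
  ... | p , k , e = ∈-concatMap⁺ (λ k → suffixes (cw k)) (lose (∈-allFin k) (∈-suffixes p e))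

  Start : Word n → Set
  Start e = ∃₂ λ i j → i ≢ j × cw i ≡ cw j ++ e

  Step : Word n → Word n → Set
  Step d e = ∃ λ k → d ≡ cw k ++ e ⊎ cw k ≡ d ++ e

  Derivable : List (Word n) → Word n → Set
  Derivable V e = Start e ⊎ Any (λ d → Step d e) V

  derivable? : ∀ V e → Dec (Derivable V e)
  derivable? V e = start? ⊎-dec Any.any? step? V
    where
      start? : Dec (Start e)
      start? = any? λ i → any? λ j → ¬? (i ≟ j) ×-dec (cw i ≟W (cw j ++ e))
      step? : ∀ d → Dec (Step d e)
      step? d = any? λ k → (d ≟W (cw k ++ e)) ⊎-dec (cw k ≟W (d ++ e))

  derivable-dangling : ∀ {V e} → All Dangling V → Derivable V e → Dangling e
  derivable-dangling _  (inj₁ (i , j , i≢j , e)) = start i≢j e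
  derivable-dangling δs (inj₂ any) with find any
  ... | d , d∈V , k , inj₁ e = strip (All.lookup δs d∈V) e
  ... | d , d∈V , k , inj₂ e = absorb (All.lookup δs d∈V) e

  Closed : List (Word n) → Set
  Closed V = ∀ {e} → e ∈ candidates → Derivable V e → e ∈ V

  closed-dangling : ∀ {V} → Closed V → ∀ {d} → Dangling d → d ∈ V
  closed-dangling cl δ@(start i≢j e) = cl (dangling∈candidates δ) (inj₁ (_ , _ , i≢j , e))
  closed-dangling cl δ@(strip δ′ e)  =
    cl (dangling∈candidates δ) (inj₂ (lose (closed-dangling cl δ′) (_ , inj₁ e)))
  closed-dangling cl δ@(absorb δ′ e) =
    cl (dangling∈candidates δ) (inj₂ (lose (closed-dangling cl δ′) (_ , inj₂ e)))

  unvisited : List (Word n) → ℕ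
  unvisited V = count (λ e → ¬? (e ∈? V)) candidates

  -- Grow a set of dangling suffixes until it is closed; each round visits a new candidate.
  saturate : (fuel : ℕ) (V : List (Word n)) → unvisited V ℕ.< fuel → All Dangling V →
             ∃ λ V′ → All Dangling V′ × Closed V′
  saturate (suc fuel) V (s≤s bound) δs with Any.any? (λ e → ¬? (e ∈? V) ×-dec derivable? V e) candidates
  ... | no ¬new = V , δs , closed
    where
      closed : Closed V
      closed {e} e∈cs der with e ∈? V
      ... | yes e∈V = e∈V
      ... | no e∉V  = ⊥-elim (¬new (lose e∈cs (e∉V , der)))
  ... | yes new with find new
  ...   | e , e∈cs , e∉V , der = saturate fuel (e ∷ V) (≤-trans fewer bound) (derivable-dangling δs der ∷ δs)
    where
      fewer : unvisited (e ∷ V) ℕ.< unvisited V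
      fewer = count-mono-< (λ x → ¬? (x ∈? (e ∷ V))) (λ x → ¬? (x ∈? V)) candidates
                (λ _ ∉eV ∈V → ∉eV (there ∈V)) e∈cs e∉V (λ ∉eV → ∉eV (here refl))

  dangling[]? : Dec (Dangling [])
  dangling[]? with saturate (suc (length candidates)) [] (s≤s (count-≤-length _ candidates)) []
  ... | V , δs , closed with [] ∈? V
  ...   | yes []∈V = yes (All.lookup δs []∈V)
  ...   | no []∉V  = no (λ δ → []∉V (closed-dangling closed δ))

  isCode? : Dec (IsCode C)
  isCode? with any? (λ k → cw k ≟W [])
  ... | yes (k , empty) =
    no λ code → case code (k ∷ []) (k ∷ k ∷ []) (λ ()) (λ ()) (both-empty empty) of λ ()
    where
      both-empty : cw k ≡ [] → F (k ∷ []) ≡ F (k ∷ k ∷ [])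
      both-empty e rewrite e = refl
  ... | no ¬empty with dangling[]?
  ...   | yes δ  = no (¬isCode δ)
  ...   | no ¬δ  = yes (isCode (λ k → ¬∃⟶∀¬ ¬empty k) ¬δ)

module _ {n m : ℕ} (C C′ : WordSeq n m) (C′≡rev : ∀ k → lookup C′ k ≡ reverse (lookup C k)) where

  flatten-reverse : ∀ is → flatten C′ (reverse is) ≡ reverse (flatten C is)
  flatten-reverse []       = refl
  flatten-reverse (i ∷ is) = begin
    flatten C′ (reverse (i ∷ is))                  ≡⟨ cong (flatten C′) (unfold-reverse i is) ⟩
    flatten C′ (reverse is ++ i ∷ [])              ≡⟨ flatten-++ C′ (reverse is) (i ∷ []) ⟩
    flatten C′ (reverse is) ++ flatten C′ (i ∷ []) ≡⟨ cong₂ _++_ (flatten-reverse is)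
                                                         (trans (flatten-singleton C′ i) (C′≡rev i)) ⟩
    reverse (flatten C is) ++ reverse (lookup C i) ≡⟨ sym (reverse-++ (lookup C i) (flatten C is)) ⟩
    reverse (flatten C (i ∷ is))                   ∎
    where open ≡-Reasoning

  isCode-reverse : IsCode C′ → IsCode C
  isCode-reverse code is js is≢[] js≢[] eq = reverse-injective (code (reverse is) (reverse js)
    (reverse-≢[] is≢[]) (reverse-≢[] js≢[])
    (trans (flatten-reverse is) (trans (cong reverse eq) (sym (flatten-reverse js)))))
    where
      reverse-≢[] : ∀ {xs : List (Fin m)} → xs ≢ [] → reverse xs ≢ []
      reverse-≢[] {xs} xs≢[] e = xs≢[] (trans (sym (reverse-involutive xs)) (cong reverse e))

triple : ∀ {n} → Word n → Word n → Word n → WordSeq n 3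
triple a b w = a Vec.∷ b Vec.∷ w Vec.∷ Vec.[]

module TwoLetters (x y : Fin 2) (x≢y : x ≢ y) where

  y≢x : y ≢ x
  y≢x = x≢y ∘′ sym

  letter : ∀ a → a ≡ x ⊎ a ≡ y
  letter a = go a x y x≢y
    where
      go : ∀ a x y → x ≢ y → a ≡ x ⊎ a ≡ y
      go zero       zero       _          _   = inj₁ refl
      go (suc zero) (suc zero) _          _   = inj₁ refl
      go zero       (suc zero) zero       _   = inj₂ refl
      go (suc zero) zero       (suc zero) _   = inj₂ refl
      go zero       (suc zero) (suc zero) x≢y = ⊥-elim (x≢y refl)
      go (suc zero) zero       zero       x≢y = ⊥-elim (x≢y refl)

  module X-YY where

    Block : Word 2 → Set
    Block u = u ≡ x ∷ [] ⊎ u ≡ y ∷ y ∷ []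

    xyx : Word 2
    xyx = x ∷ y ∷ x ∷ []

    Star-xyx-free : ∀ {t} → Star Block t → ¬ Factor xyx t
    Star-xyx-free [] f with factor-inv f
    ... | inj₁ (_ , ())
    ... | inj₂ (_ , _ , () , _)
    Star-xyx-free (inj₁ refl ∷ st) f with factor-inv f
    ... | inj₂ (_ , _ , e , f′) = Star-xyx-free st (subst (Factor xyx) (∷-injectiveʳ e) f′)
    ... | inj₁ (r , e) = y-after-x st (∷-injectiveʳ e)
      where
        y-after-x : ∀ {t r} → Star Block t → y ∷ x ∷ r ≡ t → ⊥
        y-after-x (inj₁ refl ∷ _) e = y≢x (∷-injectiveˡ e)
        y-after-x (inj₂ refl ∷ _) e = x≢y (∷-injectiveˡ (∷-injectiveʳ e))
    Star-xyx-free (inj₂ refl ∷ st) f with factor-inv f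
    ... | inj₁ (_ , e) = x≢y (∷-injectiveˡ e)
    ... | inj₂ (_ , _ , e , f′) with factor-inv (subst (Factor xyx) (∷-injectiveʳ e) f′)
    ...   | inj₁ (_ , e′) = x≢y (∷-injectiveˡ e′)
    ...   | inj₂ (_ , _ , e′ , f″) = Star-xyx-free st (subst (Factor xyx) (∷-injectiveʳ e′) f″)

    C : Word 2 → WordSeq 2 3
    C w = triple (x ∷ []) (y ∷ y ∷ []) w

    x∈B* : Star Block (x ∷ [])
    x∈B* = inj₁ refl ∷ []

    yy∈B* : Star Block (y ∷ y ∷ [])
    yy∈B* = inj₂ refl ∷ []

    module _ (w : Word 2) (xyx⊑w : Factor xyx w) where

      open Dangling (C w) using (Invariant)
      open Invariant

      ¬B*-w++ : ∀ {u s} → Star Block u → u ≢ w ++ s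
      ¬B*-w++ su e = Star-xyx-free su (subst (Factor xyx) (sym e) (factor-++ʳ _ xyx⊑w))

      ¬B*-block++ : ∀ {u s} → Block u → w ≡ u ++ s → ¬ Star Block s
      ¬B*-block++ bu e ss = Star-xyx-free (bu ∷ ss) (subst (Factor xyx) e xyx⊑w)

      nonEmpty : NonEmptyWords (C w)
      nonEmpty zero             ()
      nonEmpty (suc zero)       ()
      nonEmpty (suc (suc zero)) e = Star-xyx-free [] (subst (Factor xyx) e xyx⊑w)

      D : Word 2 → Set
      D d = ProperSuffix d w × ¬ Star Block d

      -- absorb⇒: a codeword d ++ s with d a proper suffix of w can only be w, which is then a
      -- factor of a power of s; so s ∈ Block* would make w free of xyx.
      invariant : Invariant D
      invariant .¬D[] (_ , ∉B*) = ∉B* []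
      invariant .start⇒ {zero}           {zero}           i≢j _ = ⊥-elim (i≢j refl)
      invariant .start⇒ {zero}           {suc zero}       _   e = ⊥-elim (x≢y (∷-injectiveˡ e))
      invariant .start⇒ {zero}           {suc (suc zero)} _   e = ⊥-elim (¬B*-w++ x∈B* e)
      invariant .start⇒ {suc zero}       {zero}           _   e = ⊥-elim (y≢x (∷-injectiveˡ e))
      invariant .start⇒ {suc zero}       {suc zero}       i≢j _ = ⊥-elim (i≢j refl)
      invariant .start⇒ {suc zero}       {suc (suc zero)} _   e = ⊥-elim (¬B*-w++ yy∈B* e)
      invariant .start⇒ {suc (suc zero)} {zero}           _   e =
        (x ∷ [] , (λ ()) , sym e) , ¬B*-block++ (inj₁ refl) e
      invariant .start⇒ {suc (suc zero)} {suc zero}       _   e =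
        (y ∷ y ∷ [] , (λ ()) , sym e) , ¬B*-block++ (inj₂ refl) e
      invariant .start⇒ {suc (suc zero)} {suc (suc zero)} i≢j _ = ⊥-elim (i≢j refl)
      invariant .strip⇒ {k = zero}           (d⊏w , ∉B*) e =
        ProperSuffix-drop (x ∷ []) d⊏w e , λ ss → ∉B* (subst (Star Block) (sym e) (inj₁ refl ∷ ss))
      invariant .strip⇒ {k = suc zero}       (d⊏w , ∉B*) e =
        ProperSuffix-drop (y ∷ y ∷ []) d⊏w e , λ ss → ∉B* (subst (Star Block) (sym e) (inj₂ refl ∷ ss))
      invariant .strip⇒ {k = suc (suc zero)} (d⊏w , _) e = ⊥-elim (ProperSuffix-≢++ d⊏w e)
      invariant .absorb⇒ {[]}              (_ , ∉B*) _ = ⊥-elim (∉B* [])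
      invariant .absorb⇒ {_ ∷ []}          {zero} (_ , ∉B*) e with ∷-injectiveˡ e
      ... | refl = ⊥-elim (∉B* x∈B*)
      invariant .absorb⇒ {_ ∷ _ ∷ _}       {zero} _ ()
      invariant .absorb⇒ {_ ∷ []}          {suc zero} D-d e with ∷-injectiveˡ e | ∷-injectiveʳ e
      ... | refl | refl = D-d
      invariant .absorb⇒ {_ ∷ _ ∷ []}      {suc zero} (_ , ∉B*) e with ∷-injectiveˡ e | ∷-injectiveˡ (∷-injectiveʳ e)
      ... | refl | refl = ⊥-elim (∉B* yy∈B*)
      invariant .absorb⇒ {_ ∷ _ ∷ _ ∷ _}   {suc zero} _ ()
      invariant .absorb⇒ {d@(_ ∷ _)} {suc (suc zero)} {s} (d⊏w@(e , _ , e++d≡w) , _) w≡d++s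
        with ProperSuffix-split d⊏w (λ ()) w≡d++s
      ... | s⊏w , s≢[] = s⊏w , λ ss → let k , w⊑sᵏ = factor-of-power s≢[] e++d≡w w≡d++s in
        Star-xyx-free (Star-power k ss) (factor-trans xyx⊑w w⊑sᵏ)

    isCode : ∀ w → Factor xyx w → IsCode (C w)
    isCode w xyx⊑w = Dangling.isCode-by-invariant (C w) (nonEmpty w xyx⊑w) (invariant w xyx⊑w)

  module X-XY where

    Block : Word 2 → Set
    Block u = u ≡ x ∷ [] ⊎ u ≡ x ∷ y ∷ []

    yy : Word 2
    yy = y ∷ y ∷ []

    ¬yy⊑y : ¬ Factor yy (y ∷ [])
    ¬yy⊑y f with factor-inv f
    ... | inj₁ (_ , e)          = case ∷-injectiveʳ e of λ ()
    ... | inj₂ (_ , _ , e , f′) = ¬Factor-[] (subst (Factor yy) (∷-injectiveʳ e) f′)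

    yy⊑yx⁻ : ∀ {t} → Factor yy (y ∷ x ∷ t) → Factor yy (x ∷ t)
    yy⊑yx⁻ f with factor-inv f
    ... | inj₁ (_ , e)          = ⊥-elim (x≢y (sym (∷-injectiveˡ (∷-injectiveʳ e))))
    ... | inj₂ (_ , _ , e , f′) = subst (Factor yy) (∷-injectiveʳ e) f′

    yy⊑yx-⁻ : ∀ {t} → Factor yy (y ∷ x ∷ t) → Factor yy t
    yy⊑yx-⁻ f = Factor-∷⁻ x≢y (yy⊑yx⁻ f)

    Star-yy-free : ∀ {t} → Star Block t → ¬ Factor yy t
    Star-yy-free []               f = ¬Factor-[] f
    Star-yy-free (inj₁ refl ∷ st) f = Star-yy-free st (Factor-∷⁻ x≢y f)
    Star-yy-free (inj₂ refl ∷ st) f with factor-inv (Factor-∷⁻ x≢y f)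
    ... | inj₂ (_ , _ , e , f′) = Star-yy-free st (subst (Factor yy) (∷-injectiveʳ e) f′)
    ... | inj₁ (_ , e)          = y-first st (∷-injectiveʳ e)
      where
        y-first : ∀ {t r} → Star Block t → y ∷ r ≡ t → ⊥
        y-first (inj₁ refl ∷ _) e = y≢x (∷-injectiveˡ e)
        y-first (inj₂ refl ∷ _) e = y≢x (∷-injectiveˡ e)

    yy-free⇒Star   : ∀ s → ¬ Factor yy (y ∷ s) → Star Block s
    yx-yy-free⇒Star : ∀ s → ¬ Factor yy (y ∷ x ∷ s) → Star Block (x ∷ s)
    yy-free⇒Star []      _  = []
    yy-free⇒Star (a ∷ s) ¬f with letter a
    ... | inj₁ refl = yx-yy-free⇒Star s ¬f
    ... | inj₂ refl = ⊥-elim (¬f (here s))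
    yx-yy-free⇒Star []      _  = inj₁ refl ∷ []
    yx-yy-free⇒Star (b ∷ s) ¬f with letter b
    ... | inj₁ refl = inj₁ refl ∷ yx-yy-free⇒Star s (λ f → ¬f (there y (there x (yy⊑yx⁻ f))))
    ... | inj₂ refl = inj₂ refl ∷ yy-free⇒Star s (λ f → ¬f (there y (there x f)))

    C : Word 2 → WordSeq 2 3
    C w = triple (x ∷ []) (x ∷ y ∷ []) w

    module _ (w : Word 2) (yy⊑w : Factor yy w) where

      open Dangling (C w) using (Invariant)
      open Invariant

      ¬B*-w++ : ∀ {u s} → Star Block u → u ≢ w ++ s
      ¬B*-w++ su e = Star-yy-free su (subst (Factor yy) (sym e) (factor-++ʳ _ yy⊑w))

      nonEmpty : NonEmptyWords (C w)
      nonEmpty zero             ()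
      nonEmpty (suc zero)       ()
      nonEmpty (suc (suc zero)) e = ¬Factor-[] (subst (Factor yy) e yy⊑w)

      D : Word 2 → Set
      D d = d ≡ y ∷ [] ⊎ ProperSuffix d w × Factor yy (y ∷ d)

      -- absorb⇒: as for (x, yy), if yy were not a factor of y ∷ s, then s ∈ Block* and w,
      -- a factor of a power of s, would be free of yy.
      invariant : Invariant D
      invariant .¬D[] (inj₁ ())
      invariant .¬D[] (inj₂ (_ , f)) = ¬yy⊑y f
      invariant .start⇒ {zero}           {zero}           i≢j _ = ⊥-elim (i≢j refl)
      invariant .start⇒ {zero}           {suc zero}       _   ()
      invariant .start⇒ {zero}           {suc (suc zero)} _   e = ⊥-elim (¬B*-w++ (inj₁ refl ∷ []) e)
      invariant .start⇒ {suc zero}       {zero}           _   e = inj₁ (sym (∷-injectiveʳ e))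
      invariant .start⇒ {suc zero}       {suc zero}       i≢j _ = ⊥-elim (i≢j refl)
      invariant .start⇒ {suc zero}       {suc (suc zero)} _   e = ⊥-elim (¬B*-w++ (inj₂ refl ∷ []) e)
      invariant .start⇒ {suc (suc zero)} {zero}           _   e =
        inj₂ ((x ∷ [] , (λ ()) , sym e) , there y (Factor-∷⁻ x≢y (subst (Factor yy) e yy⊑w)))
      invariant .start⇒ {suc (suc zero)} {suc zero}       _   e =
        inj₂ ((x ∷ y ∷ [] , (λ ()) , sym e) , Factor-∷⁻ x≢y (subst (Factor yy) e yy⊑w))
      invariant .start⇒ {suc (suc zero)} {suc (suc zero)} i≢j _ = ⊥-elim (i≢j refl)
      invariant .strip⇒ {k = zero}           (inj₁ refl) e = ⊥-elim (y≢x (∷-injectiveˡ e))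
      invariant .strip⇒ {k = suc zero}       (inj₁ refl) e = ⊥-elim (y≢x (∷-injectiveˡ e))
      invariant .strip⇒ {k = suc (suc zero)} (inj₁ refl) e =
        ⊥-elim (¬yy⊑y (subst (Factor yy) (sym e) (factor-++ʳ _ yy⊑w)))
      invariant .strip⇒ {k = zero}           (inj₂ (d⊏w , f)) e =
        inj₂ (ProperSuffix-drop (x ∷ []) d⊏w e , there y (yy⊑yx-⁻ (subst (λ t → Factor yy (y ∷ t)) e f)))
      invariant .strip⇒ {k = suc zero}       (inj₂ (d⊏w , f)) e =
        inj₂ (ProperSuffix-drop (x ∷ y ∷ []) d⊏w e , yy⊑yx-⁻ (subst (λ t → Factor yy (y ∷ t)) e f))
      invariant .strip⇒ {k = suc (suc zero)} (inj₂ (d⊏w , _)) e = ⊥-elim (ProperSuffix-≢++ d⊏w e)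
      invariant .absorb⇒ {k = zero}           (inj₁ refl) e = ⊥-elim (x≢y (∷-injectiveˡ e))
      invariant .absorb⇒ {k = suc zero}       (inj₁ refl) e = ⊥-elim (x≢y (∷-injectiveˡ e))
      invariant .absorb⇒ {k = suc (suc zero)} (inj₁ refl) e =
        inj₂ ((y ∷ [] , (λ ()) , sym e) , subst (Factor yy) e yy⊑w)
      invariant .absorb⇒ {d} {zero} {s} (inj₂ (_ , f)) e =
        ⊥-elim (¬Factor-[] (yy⊑yx-⁻ (subst (λ t → Factor yy (y ∷ t)) (sym e) (factor-++ʳ s f))))
      invariant .absorb⇒ {d} {suc zero} {s} (inj₂ (_ , f)) e =
        ⊥-elim (¬yy⊑y (yy⊑yx-⁻ (subst (λ t → Factor yy (y ∷ t)) (sym e) (factor-++ʳ s f))))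
      invariant .absorb⇒ {[]} {suc (suc zero)} (inj₂ (_ , f)) _ = ⊥-elim (¬yy⊑y f)
      invariant .absorb⇒ {d@(_ ∷ _)} {suc (suc zero)} {s} (inj₂ (d⊏w@(e , _ , e++d≡w) , _)) w≡d++s
        with ProperSuffix-split d⊏w (λ ()) w≡d++s | factor? _≟_ yy (y ∷ s)
      ... | s⊏w , _   | yes f = inj₂ (s⊏w , f)
      ... | _ , s≢[] | no ¬f = ⊥-elim (let k , w⊑sᵏ = factor-of-power s≢[] e++d≡w w≡d++s in
        Star-yy-free (Star-power k (yy-free⇒Star s ¬f)) (factor-trans yy⊑w w⊑sᵏ))

    isCode : ∀ w → Factor yy w → IsCode (C w)
    isCode w yy⊑w = Dangling.isCode-by-invariant (C w) (nonEmpty w yy⊑w) (invariant w yy⊑w)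

  -- (x, yx, w) is the reversal of (x, xy, reverse w).
  module X-YX where

    C : Word 2 → WordSeq 2 3
    C w = triple (x ∷ []) (y ∷ x ∷ []) w

    isCode : ∀ w → Factor X-XY.yy w → IsCode (C w)
    isCode w yy⊑w = isCode-reverse (C w) (X-XY.C (reverse w)) C′≡rev
                      (X-XY.isCode (reverse w) (factor-reverse yy⊑w))
      where
        C′≡rev : ∀ k → lookup (X-XY.C (reverse w)) k ≡ reverse (lookup (C w) k)
        C′≡rev zero             = refl
        C′≡rev (suc zero)       = refl
        C′≡rev (suc (suc zero)) = refl

words : ℕ → List (Word 2)
words zero    = [] ∷ []
words (suc c) = map (zero ∷_) (words c) ++ map (suc zero ∷_) (words c)

∈-words⁺ : ∀ {c} (w : Word 2) → length w ≡ c → w ∈ words c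
∈-words⁺ {zero}  []             refl = here refl
∈-words⁺ {suc c} (zero ∷ w)     e    = ∈-++⁺ˡ (∈-map⁺ (zero ∷_) (∈-words⁺ w (suc-injective e)))
∈-words⁺ {suc c} (suc zero ∷ w) e    = ∈-++⁺ʳ _ (∈-map⁺ (suc zero ∷_) (∈-words⁺ w (suc-injective e)))

∈-words⁻ : ∀ c {w} → w ∈ words c → length w ≡ c
∈-words⁻ zero    (here refl) = refl
∈-words⁻ (suc c) w∈ with ∈-++⁻ (map (zero ∷_) (words c)) w∈
... | inj₁ w∈₀ with ∈-map⁻ (zero ∷_) w∈₀
...   | _ , w′∈ , refl = cong suc (∈-words⁻ c w′∈)
∈-words⁻ (suc c) w∈ | inj₂ w∈₁ with ∈-map⁻ (suc zero ∷_) w∈₁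
...   | _ , w′∈ , refl = cong suc (∈-words⁻ c w′∈)

words-unique : ∀ c → Unique (words c)
words-unique zero    = [] ∷ []
words-unique (suc c) = ++⁺ (map⁺ ∷-injectiveʳ (words-unique c)) (map⁺ ∷-injectiveʳ (words-unique c)) disjoint
  where
    disjoint : ∀ {w} → ¬ (w ∈ map (zero ∷_) (words c) × w ∈ map (suc zero ∷_) (words c))
    disjoint (w∈₀ , w∈₁) with ∈-map⁻ (zero ∷_) w∈₀ | ∈-map⁻ (suc zero ∷_) w∈₁
    ... | _ , _ , refl | _ , _ , ()

length-words : ∀ c → length (words c) ≡ 2 ^ c
length-words zero    = refl
length-words (suc c) = begin
  length (map (zero ∷_) (words c) ++ map (suc zero ∷_) (words c))
    ≡⟨ length-++ (map (zero ∷_) (words c)) ⟩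
  length (map (zero ∷_) (words c)) + length (map (suc zero ∷_) (words c))
    ≡⟨ cong₂ _+_ (length-map _ (words c)) (length-map _ (words c)) ⟩
  length (words c) + length (words c)
    ≡⟨ cong₂ _+_ (length-words c) (trans (length-words c) (sym (+-identityʳ (2 ^ c)))) ⟩
  2 ^ suc c ∎
  where open ≡-Reasoning

count-words-+ : ∀ {P : Word 2 → Set} (P? : Decidable P) k c →
  count P? (words (k + c)) ≡ sum (map (λ u → count (λ w → P? (u ++ w)) (words c)) (words k))
count-words-+ P? zero    c = sym (+-identityʳ _)
count-words-+ P? (suc k) c = begin
  count P? (map (zero ∷_) (words (k + c)) ++ map (suc zero ∷_) (words (k + c)))
    ≡⟨ count-++ P? (map (zero ∷_) (words (k + c))) _ ⟩
  count P? (map (zero ∷_) (words (k + c))) + count P? (map (suc zero ∷_) (words (k + c)))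
    ≡⟨ cong₂ _+_ (count-map P? (zero ∷_) (words (k + c))) (count-map P? (suc zero ∷_) (words (k + c))) ⟩
  count (λ w → P? (zero ∷ w)) (words (k + c)) + count (λ w → P? (suc zero ∷ w)) (words (k + c))
    ≡⟨ cong₂ _+_ (count-words-+ (λ w → P? (zero ∷ w)) k c) (count-words-+ (λ w → P? (suc zero ∷ w)) k c) ⟩
  sum (map (g ∘′ (zero ∷_)) (words k)) + sum (map (g ∘′ (suc zero ∷_)) (words k))
    ≡⟨ cong₂ _+_ (cong sum (map-∘ (words k))) (cong sum (map-∘ (words k))) ⟩
  sum (map g (map (zero ∷_) (words k))) + sum (map g (map (suc zero ∷_) (words k)))
    ≡⟨ sym (sum-++ (map g (map (zero ∷_) (words k))) _) ⟩
  sum (map g (map (zero ∷_) (words k)) ++ map g (map (suc zero ∷_) (words k)))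
    ≡⟨ cong sum (sym (map-++ g (map (zero ∷_) (words k)) _)) ⟩
  sum (map g (words (suc k))) ∎
  where
    open ≡-Reasoning
    g : Word 2 → ℕ
    g u = count (λ w → P? (u ++ w)) (words c)

avoiders : Word 2 → ℕ → ℕ
avoiders q c = count (λ w → ¬? (factor? _≟_ q w)) (words c)

-- Of the 2 ^ l extensions of a word by a block of length l, the block u already contains q.
avoiders-step : ∀ {q u} l c → Factor q u → length u ≡ l →
                avoiders q (l + c) + avoiders q c ≤ 2 ^ l * avoiders q c
avoiders-step {q} {u} l c q⊑u |u|≡l = begin
  avoiders q (l + c) + M      ≡⟨ cong (_+ M) (count-words-+ (λ w → ¬? (factor? _≟_ q w)) l c) ⟩
  sum (map g (words l)) + M   ≤⟨ sum+b≤length*b g M (words l) (λ _ → g≤M _) (∈-words⁺ u |u|≡l) g[u]≡0 ⟩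
  length (words l) * M        ≡⟨ cong (_* M) (length-words l) ⟩
  2 ^ l * M                   ∎
  where
    open ≤-Reasoning
    M : ℕ
    M = avoiders q c
    g : Word 2 → ℕ
    g v = count (λ w → ¬? (factor? _≟_ q (v ++ w))) (words c)
    g≤M : ∀ v → g v ≤ M
    g≤M v = count-mono _ _ (words c) (λ _ ¬q⊑vw q⊑w → ¬q⊑vw (factor-++ˡ v q⊑w))
    g[u]≡0 : g u ≡ 0
    g[u]≡0 = count-none _ (words c) (λ _ ¬q⊑uw → ¬q⊑uw (factor-++ʳ _ q⊑u))

avoiders-bound : ∀ {q u} l k r → Factor q u → length u ≡ l →
                 avoiders q (k * l + r) ≤ (2 ^ l ∸ 1) ^ k * 2 ^ r
avoiders-bound {q} l zero r _ _ = begin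
  avoiders q r       ≤⟨ count-≤-length _ (words r) ⟩
  length (words r)   ≡⟨ length-words r ⟩
  2 ^ r              ≡⟨ sym (+-identityʳ (2 ^ r)) ⟩
  1 * 2 ^ r          ∎
  where open ≤-Reasoning
avoiders-bound {q} l (suc k) r q⊑u |u|≡l = begin
  avoiders q ((l + k * l) + r)    ≡⟨ cong (avoiders q) (+-assoc l (k * l) r) ⟩
  avoiders q (l + c)              ≤⟨ m+n≤o⇒m≤o∸n _ (avoiders-step l c q⊑u |u|≡l) ⟩
  2 ^ l * M ∸ M                   ≡⟨ cong (2 ^ l * M ∸_) (sym (+-identityʳ M)) ⟩
  2 ^ l * M ∸ 1 * M               ≡⟨ sym (*-distribʳ-∸ M (2 ^ l) 1) ⟩
  (2 ^ l ∸ 1) * M                 ≤⟨ *-monoʳ-≤ (2 ^ l ∸ 1) (avoiders-bound l k r q⊑u |u|≡l) ⟩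
  (2 ^ l ∸ 1) * ((2 ^ l ∸ 1) ^ k * 2 ^ r) ≡⟨ sym (*-assoc (2 ^ l ∸ 1) _ (2 ^ r)) ⟩
  (2 ^ l ∸ 1) ^ suc k * 2 ^ r     ∎
  where
    open ≤-Reasoning
    c : ℕ
    c = k * l + r
    M : ℕ
    M = avoiders q c

_⇔?_ : {A B : Set} → Dec A → Dec B → Dec (A ⇔ B)
A? ⇔? B? = map′ (λ (to , from) → mk⇔ to from) (λ e → Equivalence.to e , Equivalence.from e)
                ((A? →-dec B?) ×-dec (B? →-dec A?))

hasLengths? : ∀ {n m} (L : Vec ℕ m) (C : WordSeq n m) → Dec (HasLengths L C)
hasLengths? L C = all? λ i → length (lookup C i) ℕ.≟ lookup L i

inUD? : ∀ n {m} (L : Vec ℕ m) → Decidable (InUD n L)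
inUD? n L C = hasLengths? L C ×-dec Dangling.isCode? C

inPR? : ∀ n {m} (L : Vec ℕ m) → Decidable (InPR n L)
inPR? n L C = hasLengths? L C ×-dec (Dangling.isCode? C ×-dec
  all? λ i → all? λ j → isPrefix? _≟_ (lookup C i) (lookup C j) ⇔? (i ≟ j))

pairs : List (Word 2 × Word 2)
pairs = cartesianProduct (words 1) (words 2)

toTriple : (Word 2 × Word 2) × Word 2 → WordSeq 2 3
toTriple ((a , b) , w) = triple a b w

triples : ℕ → List (WordSeq 2 3)
triples c = map toTriple (cartesianProduct pairs (words c))

triples-unique : ∀ c → Unique (triples c)
triples-unique c = map⁺ toTriple-injective
  (cartesianProduct⁺ (cartesianProduct⁺ (words-unique 1) (words-unique 2)) (words-unique c))
  where
    toTriple-injective : ∀ {p q} → toTriple p ≡ toTriple q → p ≡ q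
    toTriple-injective {(a , b) , w} e with Vecₚ.∷-injective e
    ... | refl , e′ with Vecₚ.∷-injective e′
    ...   | refl , e″ with Vecₚ.∷-injective e″
    ...     | refl , _ = refl

∈-triples : ∀ c {C} → HasLengths (Lc c) C → C ∈ triples c
∈-triples c {a Vec.∷ b Vec.∷ w Vec.∷ Vec.[]} lengths = ∈-map⁺ toTriple
  (∈-cartesianProduct⁺ (∈-cartesianProduct⁺ (∈-words⁺ a (lengths zero)) (∈-words⁺ b (lengths (suc zero))))
                       (∈-words⁺ w (lengths (suc (suc zero)))))

hasCard : ∀ c {P : WordSeq 2 3 → Set} (P? : Decidable P) → (∀ {C} → P C → HasLengths (Lc c) C) →
          HasCard P (count P? (triples c))
hasCard c P? lengths = filter P? (triples c) , refl , filter⁺ P? (triples-unique c) ,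
  all-filter P? (triples c) , λ C pc → ∈-filter⁺ P? (∈-triples c (lengths pc)) pc

fibre : {P : WordSeq 2 3 → Set} → Decidable P → ℕ → Word 2 × Word 2 → ℕ
fibre P? c (a , b) = count (λ w → P? (triple a b w)) (words c)

count-triples : ∀ c {P : WordSeq 2 3 → Set} (P? : Decidable P) →
                count P? (triples c) ≡ sum (map (fibre P? c) pairs)
count-triples c P? = trans (count-map P? toTriple (cartesianProduct pairs (words c)))
                           (count-cartesianProduct (λ abw → P? (toTriple abw)) pairs (words c))

fibre-≤ : ∀ c {P : WordSeq 2 3 → Set} (P? : Decidable P) ab → fibre P? c ab ≤ 2 ^ c
fibre-≤ c P? (a , b) = subst (fibre P? c (a , b) ≤_) (length-words c) (count-≤-length _ (words c))

Degenerate : Word 2 × Word 2 → Set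
Degenerate (a , b) = b ≡ a ++ a

degenerate? : Decidable Degenerate
degenerate? (a , b) = ≡-dec _≟_ b (a ++ a)

¬isCode-degenerate : ∀ {n} {a b w : Word n} → b ≡ a ++ a → ¬ IsCode (triple a b w)
¬isCode-degenerate {a = a} refl code with code (zero ∷ zero ∷ []) (suc zero ∷ []) (λ ()) (λ ()) (sym (++-assoc a a []))
... | ()

record FactorForcesCode (a b : Word 2) : Set where
  field
    q u     : Word 2
    q⊑u     : Factor q u
    |u|≡3   : length u ≡ 3
    forces  : ∀ w → Factor q w → IsCode (triple a b w)

factorForcesCode : ∀ x y t → ¬ Degenerate (x ∷ [] , y ∷ t ∷ []) → FactorForcesCode (x ∷ []) (y ∷ t ∷ [])
factorForcesCode zero       zero       zero       deg = ⊥-elim (deg refl)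
factorForcesCode zero       zero       (suc zero) _   = record
  { q⊑u = here (suc zero ∷ []) ; |u|≡3 = refl ; forces = TwoLetters.X-XY.isCode zero (suc zero) (λ ()) }
factorForcesCode zero       (suc zero) zero       _   = record
  { q⊑u = here (suc zero ∷ []) ; |u|≡3 = refl ; forces = TwoLetters.X-YX.isCode zero (suc zero) (λ ()) }
factorForcesCode zero       (suc zero) (suc zero) _   = record
  { q⊑u = factor-refl _ ; |u|≡3 = refl ; forces = TwoLetters.X-YY.isCode zero (suc zero) (λ ()) }
factorForcesCode (suc zero) zero       zero       _   = record
  { q⊑u = factor-refl _ ; |u|≡3 = refl ; forces = TwoLetters.X-YY.isCode (suc zero) zero (λ ()) }
factorForcesCode (suc zero) zero       (suc zero) _   = record
  { q⊑u = here (zero ∷ []) ; |u|≡3 = refl ; forces = TwoLetters.X-YX.isCode (suc zero) zero (λ ()) }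
factorForcesCode (suc zero) (suc zero) zero       _   = record
  { q⊑u = here (zero ∷ []) ; |u|≡3 = refl ; forces = TwoLetters.X-XY.isCode (suc zero) zero (λ ()) }
factorForcesCode (suc zero) (suc zero) (suc zero) deg = ⊥-elim (deg refl)

∈-pairs⁻ : ∀ {a b} → (a , b) ∈ pairs → ∃₂ λ x y → ∃ λ t → a ≡ x ∷ [] × b ≡ y ∷ t ∷ []
∈-pairs⁻ {a} {b} ab∈ with ∈-cartesianProduct⁻ (words 1) (words 2) ab∈
... | a∈ , b∈ = shape a b (∈-words⁻ 1 a∈) (∈-words⁻ 2 b∈)
  where
    shape : ∀ a b → length a ≡ 1 → length b ≡ 2 → ∃₂ λ x y → ∃ λ t → a ≡ x ∷ [] × b ≡ y ∷ t ∷ []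
    shape (x ∷ []) (y ∷ t ∷ []) _ _ = x , y , t , refl , refl

triple-lengths : ∀ {c a b w} → (a , b) ∈ pairs → w ∈ words c → HasLengths (Lc c) (triple a b w)
triple-lengths {c} ab∈ w∈ with ∈-pairs⁻ ab∈
... | _ , _ , _ , refl , refl = λ { zero → refl ; (suc zero) → refl ; (suc (suc zero)) → ∈-words⁻ c w∈ }

module _ (c : ℕ) where

  private
    UD? : Decidable (InUD 2 (Lc c))
    UD? = inUD? 2 (Lc c)

  UD-fibre-degenerate : ∀ ab → Degenerate ab → fibre UD? c ab ≡ 0
  UD-fibre-degenerate (a , b) deg = count-none _ (words c) (λ _ (_ , code) → ¬isCode-degenerate deg code)

  UD-fibre-≥ : ∀ {a b} → (a , b) ∈ pairs → (forcing : FactorForcesCode a b) →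
               2 ^ c ≤ fibre UD? c (a , b) + avoiders (FactorForcesCode.q forcing) c
  UD-fibre-≥ {a} {b} ab∈ forcing = begin
    2 ^ c                                 ≡⟨ sym (length-words c) ⟩
    length (words c)                      ≡⟨ sym (count-complement (factor? _≟_ q) (words c)) ⟩
    count (factor? _≟_ q) (words c) + avoiders q c
      ≤⟨ +-monoˡ-≤ (avoiders q c) (count-mono _ _ (words c) (λ w∈ q⊑w → triple-lengths ab∈ w∈ , forces _ q⊑w)) ⟩
    fibre UD? c (a , b) + avoiders q c    ∎
    where
      open FactorForcesCode forcing
      open ≤-Reasoning

  private
    forcing : ∀ {a b} → (a , b) ∈ pairs → ¬ Degenerate (a , b) → FactorForcesCode a b
    forcing ab∈ ¬deg with ∈-pairs⁻ ab∈
    ... | x , y , t , refl , refl = factorForcesCode x y t ¬deg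

  UD-count-≤ : count UD? (triples c) ≤ 6 * 2 ^ c
  UD-count-≤ = subst (_≤ 6 * 2 ^ c) (sym (count-triples c UD?))
    (sum≤count* (λ ab → ¬? (degenerate? ab)) (fibre UD? c) (2 ^ c) pairs (λ {ab} _ _ → fibre-≤ c UD? ab)
      (λ {ab} _ ¬¬deg → UD-fibre-degenerate ab (decidable-stable (degenerate? ab) ¬¬deg)))

  UD-count-≥ : ∀ k r → c ≡ k * 3 + r → 6 * 2 ^ c ≤ count UD? (triples c) + 6 * (7 ^ k * 2 ^ r)
  UD-count-≥ k r refl = subst (λ u → 6 * 2 ^ c ≤ u + 6 * (7 ^ k * 2 ^ r)) (sym (count-triples c UD?))
    (count*≤sum+count* (λ ab → ¬? (degenerate? ab)) (fibre UD? c) (2 ^ c) (7 ^ k * 2 ^ r) pairs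
      λ ab∈ ¬deg → let forced = forcing ab∈ ¬deg; open FactorForcesCode forced in
        ≤-trans (UD-fibre-≥ ab∈ forced) (+-monoʳ-≤ _ (avoiders-bound 3 k r q⊑u |u|≡3)))

PrefixFree : Word 2 → Word 2 → Word 2 → Set
PrefixFree a b v = ¬ IsPrefix a b × ¬ IsPrefix a v × ¬ IsPrefix b v

prefixFree? : ∀ a b → Decidable (PrefixFree a b)
prefixFree? a b v = ¬? (isPrefix? _≟_ a b) ×-dec ¬? (isPrefix? _≟_ a v) ×-dec ¬? (isPrefix? _≟_ b v)

PR⇒prefixFree : ∀ {c a b v w′} → InPR 2 (Lc c) (triple a b (v ++ w′)) → PrefixFree a b v
PR⇒prefixFree {w′ = w′} (_ , _ , prefix⇔) =
    (λ a⊑b → case Equivalence.to (prefix⇔ zero (suc zero)) a⊑b of λ ())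
  , (λ a⊑v → case Equivalence.to (prefix⇔ zero (suc (suc zero))) (IsPrefix-++ w′ a⊑v) of λ ())
  , (λ b⊑v → case Equivalence.to (prefix⇔ (suc zero) (suc (suc zero))) (IsPrefix-++ w′ b⊑v) of λ ())

-- Only the first two letters of the long word can interfere with the words of length 1 and 2.
prefixFree⇒PR : ∀ {x y t v₀ v₁ w′} → PrefixFree (x ∷ []) (y ∷ t ∷ []) (v₀ ∷ v₁ ∷ []) →
                InPR 2 (Lc (2 + length w′)) (triple (x ∷ []) (y ∷ t ∷ []) (v₀ ∷ v₁ ∷ w′))
prefixFree⇒PR {x} {y} {t} {v₀} {v₁} {w′} (¬a⊑b , ¬a⊑v , ¬b⊑v) =
  lengths , Dangling.isCode-prefixFree C nonEmpty (λ i≢j j⊑i → i≢j (sym (prefix⇒≡ _ _ j⊑i))) ,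
  λ i j → mk⇔ (prefix⇒≡ i j) λ { refl → IsPrefix-refl _ }
  where
    C : WordSeq 2 3
    C = triple (x ∷ []) (y ∷ t ∷ []) (v₀ ∷ v₁ ∷ w′)

    lengths : HasLengths (Lc (2 + length w′)) C
    lengths zero             = refl
    lengths (suc zero)       = refl
    lengths (suc (suc zero)) = refl

    nonEmpty : NonEmptyWords C
    nonEmpty zero             ()
    nonEmpty (suc zero)       ()
    nonEmpty (suc (suc zero)) ()

    prefix⇒≡ : ∀ i j → IsPrefix (lookup C i) (lookup C j) → i ≡ j
    prefix⇒≡ zero             zero             _ = refl
    prefix⇒≡ zero             (suc zero)       p = ⊥-elim (¬a⊑b p)
    prefix⇒≡ zero             (suc (suc zero)) p = ⊥-elim (¬a⊑v (IsPrefix-++⁻ p (s≤s z≤n)))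
    prefix⇒≡ (suc zero)       zero             p with IsPrefix-length p
    ... | s≤s ()
    prefix⇒≡ (suc zero)       (suc zero)       _ = refl
    prefix⇒≡ (suc zero)       (suc (suc zero)) p = ⊥-elim (¬b⊑v (IsPrefix-++⁻ p (s≤s (s≤s z≤n))))
    prefix⇒≡ (suc (suc zero)) zero             p with IsPrefix-length p
    ... | s≤s ()
    prefix⇒≡ (suc (suc zero)) (suc zero)       p =
      ⊥-elim (¬b⊑v (subst (IsPrefix (y ∷ t ∷ [])) (sym v≡b) (IsPrefix-refl _)))
      where
        v≡b : v₀ ∷ v₁ ∷ [] ≡ y ∷ t ∷ []
        v≡b = IsPrefix-≡ (IsPrefix-++⁻ˡ {u = v₀ ∷ v₁ ∷ []} p) (s≤s (s≤s z≤n))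
    prefix⇒≡ (suc (suc zero)) (suc (suc zero)) _ = refl

module _ (c′ : ℕ) where

  private
    PR? : Decidable (InPR 2 (Lc (2 + c′)))
    PR? = inPR? 2 (Lc (2 + c′))

  PR-fibre : ∀ {a b} → (a , b) ∈ pairs → fibre PR? (2 + c′) (a , b) ≡ count (prefixFree? a b) (words 2) * 2 ^ c′
  PR-fibre {a} {b} ab∈ with ∈-pairs⁻ ab∈
  ... | x , y , t , refl , refl =
    trans (count-words-+ (λ w → PR? (triple a b w)) 2 c′)
          (sum≡count* (prefixFree? a b) g (2 ^ c′) (words 2) full empty)
    where
      g : Word 2 → ℕ
      g v = count (λ w′ → PR? (triple a b (v ++ w′))) (words c′)

      full : ∀ {v} → v ∈ words 2 → PrefixFree a b v → g v ≡ 2 ^ c′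
      full {v₀ ∷ v₁ ∷ []} _ pf = trans
        (count-all _ (words c′) (λ {w′} w′∈ →
          subst (λ l → InPR 2 (Lc (2 + l)) (triple a b (v₀ ∷ v₁ ∷ w′))) (∈-words⁻ c′ w′∈) (prefixFree⇒PR pf)))
        (length-words c′)
      full {[]}               v∈ _ = case ∈-words⁻ 2 v∈ of λ ()
      full {_ ∷ []}           v∈ _ = case ∈-words⁻ 2 v∈ of λ ()
      full {_ ∷ _ ∷ _ ∷ _}    v∈ _ = case ∈-words⁻ 2 v∈ of λ ()

      empty : ∀ {v} → v ∈ words 2 → ¬ PrefixFree a b v → g v ≡ 0
      empty _ ¬pf = count-none _ (words c′) (λ _ pr → ¬pf (PR⇒prefixFree pr))

  PR-count : count PR? (triples (2 + c′)) ≡ 2 ^ (2 + c′)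
  PR-count = begin
    count PR? (triples (2 + c′))                        ≡⟨ count-triples (2 + c′) PR? ⟩
    sum (map (fibre PR? (2 + c′)) pairs)                ≡⟨ cong sum (map-cong-local (All.tabulate PR-fibre′)) ⟩
    sum (map (λ ab → prefixFreeCount ab * 2 ^ c′) pairs) ≡⟨ sum-map-*ʳ prefixFreeCount (2 ^ c′) pairs ⟩
    4 * 2 ^ c′                                          ≡⟨ *-assoc 2 2 (2 ^ c′) ⟩
    2 ^ (2 + c′)                                        ∎
    where
      open ≡-Reasoning
      prefixFreeCount : Word 2 × Word 2 → ℕ
      prefixFreeCount (a , b) = count (prefixFree? a b) (words 2)
      PR-fibre′ : ∀ {ab} → ab ∈ pairs → fibre PR? (2 + c′) ab ≡ prefixFreeCount ab * 2 ^ c′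
      PR-fibre′ {a , b} = PR-fibre

-- Bernoulli's inequality for (8/7)^k, cleared of denominators.
[7+k]*7^k≤7*8^k : ∀ k → (7 + k) * 7 ^ k ≤ 7 * 8 ^ k
[7+k]*7^k≤7*8^k zero    = ≤-refl
[7+k]*7^k≤7*8^k (suc k) = begin
  (8 + k) * (7 * 7 ^ k)              ≤⟨ m≤m+n _ (k * 7 ^ k) ⟩
  (8 + k) * (7 * 7 ^ k) + k * 7 ^ k  ≡⟨ lemma k (7 ^ k) ⟩
  8 * ((7 + k) * 7 ^ k)              ≤⟨ *-monoʳ-≤ 8 ([7+k]*7^k≤7*8^k k) ⟩
  8 * (7 * 8 ^ k)                    ≡⟨ lemma′ (8 ^ k) ⟩
  7 * (8 * 8 ^ k)                    ∎
  where
    open ≤-Reasoning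
    lemma : ∀ k x → (8 + k) * (7 * x) + k * x ≡ 8 * ((7 + k) * x)
    lemma = solve-∀
    lemma′ : ∀ y → 8 * (7 * y) ≡ 7 * (8 * y)
    lemma′ = solve-∀

7^k*D<8^k : ∀ D k → 7 * D ≤ k → 7 ^ k * D ℕ.< 8 ^ k
7^k*D<8^k D k 7D≤k = *-cancelˡ-< 7 _ _ (begin-strict
  7 * (7 ^ k * D)   ≡⟨ lemma (7 ^ k) D ⟩
  (7 * D) * 7 ^ k   ≤⟨ *-monoˡ-≤ (7 ^ k) 7D≤k ⟩
  k * 7 ^ k         <⟨ *-monoˡ-< (7 ^ k) {{m^n≢0 7 k}} (m≤n+m (suc k) 6) ⟩
  (7 + k) * 7 ^ k   ≤⟨ [7+k]*7^k≤7*8^k k ⟩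
  7 * 8 ^ k         ∎)
  where
    open ≤-Reasoning
    lemma : ∀ x D → 7 * (x * D) ≡ (7 * D) * x
    lemma = solve-∀

2^[k*3+r] : ∀ k r → 2 ^ (k * 3 + r) ≡ 8 ^ k * 2 ^ r
2^[k*3+r] k r = trans (^-distribˡ-+-* 2 (k * 3) r)
  (cong (_* 2 ^ r) (trans (cong (2 ^_) (*-comm k 3)) (sym (^-*-assoc 2 3 k))))

p/u-1/6≡m/6u : ∀ p u₀ m → m + suc u₀ ≡ p * 6 → (+ p) / suc u₀ - (+ 1) / 6 ≡ (+ m) / (suc u₀ * 6)
p/u-1/6≡m/6u p u₀ m m+u≡6p = ℚₚ.toℚᵘ-injective (begin
  toℚᵘ ((+ p) / suc u₀ - (+ 1) / 6)       ≈⟨ ℚₚ.toℚᵘ-homo-+ (fromℚᵘ P) (ℚ.- fromℚᵘ S) ⟩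
  toℚᵘ (fromℚᵘ P) ℚᵘ.+ toℚᵘ (ℚ.- fromℚᵘ S) ≈⟨ ℚᵘₚ.+-cong (ℚₚ.toℚᵘ-fromℚᵘ P)
                                                 (ℚᵘₚ.≃-trans (ℚₚ.toℚᵘ-homo‿- (fromℚᵘ S)) (ℚᵘₚ.-‿cong (ℚₚ.toℚᵘ-fromℚᵘ S))) ⟩
  P ℚᵘ.+ ℚᵘ.- S                           ≈⟨ ℚᵘ.*≡* (cong (ℤ._* (+ suc (5 + u₀ * 6))) numerator) ⟩
  M                                       ≈⟨ ℚᵘₚ.≃-sym (ℚₚ.toℚᵘ-fromℚᵘ M) ⟩
  toℚᵘ ((+ m) / (suc u₀ * 6))             ∎)
  where
    open ℚᵘₚ.≃-Reasoning
    P S M : ℚᵘ.ℚᵘ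
    P = ℚᵘ.mkℚᵘ (+ p) u₀
    S = ℚᵘ.mkℚᵘ (+ 1) 5
    M = ℚᵘ.mkℚᵘ (+ m) (5 + u₀ * 6)
    u≤6p : suc u₀ ≤ p * 6
    u≤6p = subst (suc u₀ ≤_) m+u≡6p (m≤n+m (suc u₀) m)
    numerator : (+ p) ℤ.* (+ 6) ℤ.+ (ℤ.- (+ 1)) ℤ.* (+ suc u₀) ≡ + m
    numerator = trans (cong₂ ℤ._+_ (sym (ℤₚ.pos-* p 6)) (ℤₚ.-1*i≡-i (+ suc u₀)))
      (trans (ℤₚ.m-n≡m⊖n (p * 6) (suc u₀))
      (trans (ℤₚ.⊖-≥ u≤6p) (cong +_ (trans (cong (_∸ suc u₀) (sym m+u≡6p)) (m+n∸n≡m m (suc u₀))))))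

m/d<mkℚ : ∀ m d′ n d .(cop : Coprime (suc n) (suc d)) → m * suc d ℕ.< suc n * suc d′ →
          (+ m) / suc d′ < mkℚ +[1+ n ] d cop
m/d<mkℚ m d′ n d _ m*d<n*d′ = ℚₚ.toℚᵘ-cancel-<
  (ℚᵘₚ.<-respˡ-≃ (ℚᵘₚ.≃-sym (ℚₚ.toℚᵘ-fromℚᵘ (ℚᵘ.mkℚᵘ (+ m) d′)))
                (ℚᵘ.*<* (subst₂ ℤ._<_ (ℤₚ.pos-* m (suc d)) (ℤₚ.pos-* (suc n) (suc d′)) (+<+ m*d<n*d′))))

∣m/d∣≡m/d : ∀ m d .{{_ : NonZero d}} → ∣ (+ m) / d ∣ ≡ (+ m) / d
∣m/d∣≡m/d m d = ℚₚ.0≤p⇒∣p∣≡p (ℚₚ.nonNegative⁻¹ ((+ m) / d) {{ℚₚ.normalize-nonNeg m d}})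

-- With u ≥ p, the distance (6p - u) / 6u is at most B / p.
ratio-near-1/6 : ∀ {p u B} n d .(cop : Coprime (suc n) (suc d)) →
                 u ≤ 6 * p → 6 * p ≤ u + 6 * B → p ≤ u → B * suc d ℕ.< p →
                 ∣ ratio p u - (+ 1) / 6 ∣ < mkℚ +[1+ n ] d cop
ratio-near-1/6 {p} {zero} n d cop _ _ p≤0 BD<p = ⊥-elim (m<n⇒n≢0 BD<p (n≤0⇒n≡0 p≤0))
ratio-near-1/6 {p} {suc u₀} {B} n d cop u≤6p 6p≤u+6B p≤u BD<p =
  subst (_< mkℚ +[1+ n ] d cop)
        (sym (trans (cong ∣_∣ (p/u-1/6≡m/6u p u₀ m m+u≡6p)) (∣m/d∣≡m/d m (suc u₀ * 6))))
        (m/d<mkℚ m (5 + u₀ * 6) n d cop (begin-strict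
          m * suc d               ≤⟨ *-monoˡ-≤ (suc d) m≤6B ⟩
          6 * B * suc d           ≡⟨ *-assoc 6 B (suc d) ⟩
          6 * (B * suc d)         <⟨ *-monoʳ-< 6 BD<p ⟩
          6 * p                   ≤⟨ *-monoʳ-≤ 6 p≤u ⟩
          6 * suc u₀              ≡⟨ *-comm 6 (suc u₀) ⟩
          suc u₀ * 6              ≤⟨ m≤m+n (suc u₀ * 6) (n * (suc u₀ * 6)) ⟩
          suc n * (suc u₀ * 6)    ∎))
  where
    open ≤-Reasoning
    m : ℕ
    m = p * 6 ∸ suc u₀
    m+u≡6p : m + suc u₀ ≡ p * 6
    m+u≡6p = m∸n+n≡m (subst (suc u₀ ≤_) (*-comm 6 p) u≤6p)
    m≤6B : m ≤ 6 * B
    m≤6B = m≤n+o⇒m∸n≤o (p * 6) (suc u₀) (subst (_≤ suc u₀ + 6 * B) (*-comm 6 p) 6p≤u+6B)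

7^k*2^r*D<2^[k*3+r] : ∀ D k r → 7 * D ≤ k → 7 ^ k * 2 ^ r * D ℕ.< 2 ^ (k * 3 + r)
7^k*2^r*D<2^[k*3+r] D k r 7D≤k = begin-strict
  7 ^ k * 2 ^ r * D   ≡⟨ lemma (7 ^ k) (2 ^ r) D ⟩
  7 ^ k * D * 2 ^ r   <⟨ *-monoˡ-< (2 ^ r) {{m^n≢0 2 r}} (7^k*D<8^k D k 7D≤k) ⟩
  8 ^ k * 2 ^ r       ≡⟨ sym (2^[k*3+r] k r) ⟩
  2 ^ (k * 3 + r)     ∎
  where
    open ≤-Reasoning
    lemma : ∀ x y D → x * y * D ≡ x * D * y
    lemma = solve-∀

theorem6 : (ε : ℚ) → 0ℚ < ε → Σ ℕ λ N → (c : ℕ) → c ≥ 2 → c ≥ N →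
    Σ ℕ λ u → Σ ℕ λ p →
      HasCard (InUD 2 (Lc c)) u × HasCard (InPR 2 (Lc c)) p ×
      (∣ ratio p u - (+ 1) / 6 ∣ < ε)
theorem6 (mkℚ (+ zero)   _ _)   (*<* (+<+ ()))
theorem6 (mkℚ -[1+ _ ]   _ _)   (*<* ())
theorem6 (mkℚ +[1+ n ]   d cop) _ = let k = 7 * suc d in k * 3 , λ where
  c@(suc (suc c′)) (s≤s (s≤s _)) c≥k*3 →
    let UD? = inUD? 2 (Lc c)
        PR? = inPR? 2 (Lc c)
        u   = count UD? (triples c)
        p   = count PR? (triples c)
        r   = c ∸ k * 3
        B   = 7 ^ k * 2 ^ r
        c≡k*3+r = sym (m+[n∸m]≡n c≥k*3)
        2^c≡p   = sym (PR-count c′)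
    in u , p , hasCard c UD? proj₁ , hasCard c PR? proj₁ ,
       ratio-near-1/6 {p} {u} {B} n d cop
         (subst (λ p → u ≤ 6 * p) 2^c≡p (UD-count-≤ c))
         (subst (λ p → 6 * p ≤ u + 6 * B) 2^c≡p (UD-count-≥ c k r c≡k*3+r))
         (count-mono PR? UD? (triples c) (λ _ (lengths , code , _) → lengths , code))
         (subst (B * suc d ℕ.<_) (trans (cong (2 ^_) (sym c≡k*3+r)) 2^c≡p)
                (7^k*2^r*D<2^[k*3+r] (suc d) k r ≤-refl))
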